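{- Let $G$ be a connected bipartite graph with bipartition $(X,Y)$ such that $2\le |X|\le |Y|$. Then $\mathrm{cap}^\times_2(G)\le |X|$. Moreover, if $G$ is a complete bipartite graph, then $\mathrm{cap}^\times(G)=\mathrm{cap}^\boxtimes(G)=|X|$.
   Context: $d_G$ denotes shortest-path distance. For an integer $\ell\ge 0$, a walk (resp. weak walk) of length $\ell$ on $G$ is a function $f:\{0,\dots,\ell\}\to V(G)$ with $f(i)f(i+1)\in E(G)$ (resp. $f(i)=f(i+1)$ or $f(i)f(i+1)\in E(G)$) for all $0\le i<\ell$; an $\ell$-track (resp. weak $\ell$-track) is a surjective one. For $f,g:\{0,\dots,\ell\}\to V(G)$, $m_G(f,g)=\min_i d_G(f(i),g(i))$; for a family $F=\{f_1,\dots,f_p\}$ with $p\ge2$, $m_G(F)=\min_{i\ne j}m_G(f_i,f_j)$. An $\ell$-tour (resp. weak $\ell$-tour) is a family of $\ell$-tracks (resp. weak $\ell$-tracks). $\sigma^\times_V(G)=\max\{m_G(f,g):\ell\ge0,\ f,g\ \ell\text{ -tracks}\}$ and $\sigma^\boxtimes_V(G)$ is the same over weak $\ell$-tracks. For natural $d\le\sigma^\times_V(G)$, $\mathrm{cap}^\times_d(G)$ is the maximum $c$ such that there is an $\ell$-tour $F=\{f_1,\dots,f_c\}$ with $m_G(F)=d$, and $\mathrm{cap}^\times(G)=\mathrm{cap}^\times_{\sigma^\times_V(G)}(G)$; for natural $d\le\sigma^\boxtimes_V(G)$, $\mathrm{cap}^\boxtimes_d(G)$ is the maximum $c$ such that there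 is a weak $\ell$-tour $F=\{f_1,\dots,f_c\}$ with $m_G(F)=d$, and $\mathrm{cap}^\boxtimes(G)=\mathrm{cap}^\boxtimes_{\sigma^\boxtimes_V(G)}(G)$. -}

module Defs where

open import Data.Nat using (ℕ; zero; suc; _≤_)
open import Data.Fin using (Fin; inject₁) renaming (suc to fsuc)
open import Data.Fin.Subset using (Subset; _∈_; _∉_)
open import Data.Bool using (Bool; true; false)
open import Data.Product using (Σ; _×_; ∃; ∃-syntax)
open import Data.Sum using (_⊎_)
open import Relation.Binary.PropositionalEquality using (_≡_)
open import Relation.Nullary using (¬_)

record Graph : Set₁ where
  field
    n     : ℕ
    Adj   : Fin n → Fin n → Set
    sym   : ∀ {u v} → Adj u v → Adj v u
    irrefl : ∀ {u} → ¬ Adj u u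

module _ (G : Graph) where
  open Graph G

  V : Set
  V = Fin n

  data Walk : V → V → ℕ → Set where
    here : ∀ {u} → Walk u u 0
    step : ∀ {u w v k} → Adj u w → Walk w v k → Walk u v (suc k)

  Connected : Set
  Connected = ∀ (u v : V) → ∃[ k ] Walk u v k

  DistGe : V → V → ℕ → Set
  DistGe u v d = ∀ k → Walk u v k → d ≤ k

  Dist : V → V → ℕ → Set
  Dist u v d = Walk u v d × DistGe u v d

  -- X is one side of a bipartition (X, V ∖ X) of G.
  IsBipartition : Subset n → Set
  IsBipartition X = ∀ u v → Adj u v → (u ∈ X → v ∉ X) × (u ∉ X → v ∈ X)

  IsCompleteBipartite : Subset n → Set
  IsCompleteBipartite X = IsBipartition X × (∀ u v → u ∈ X → v ∉ X → Adj u v)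

  -- One step of a walk (weak = false) or of a weak walk (weak = true).
  Step : Bool → V → V → Set
  Step false u v = Adj u v
  Step true  u v = u ≡ v ⊎ Adj u v

  IsTrack : Bool → (ℓ : ℕ) → (Fin (suc ℓ) → V) → Set
  IsTrack w ℓ f = (∀ (i : Fin ℓ) → Step w (f (inject₁ i)) (f (fsuc i)))
                × (∀ v → ∃[ i ] f i ≡ v)

  MinDist : (ℓ : ℕ) → (Fin (suc ℓ) → V) → (Fin (suc ℓ) → V) → ℕ → Set
  MinDist ℓ f g d = (∃[ i ] Dist (f i) (g i) d) × (∀ i → DistGe (f i) (g i) d)

  IsTour : Bool → (ℓ c : ℕ) → (Fin c → Fin (suc ℓ) → V) → Set
  IsTour w ℓ c F = (∀ j → IsTrack w ℓ (F j))
                 × (∀ j k → ¬ j ≡ k → ∃[ t ] ¬ F j t ≡ F k t)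

  -- m_G(F) = d  (minimum over distinct members; requires two distinct members)
  MinDistF : (ℓ c : ℕ) → (Fin c → Fin (suc ℓ) → V) → ℕ → Set
  MinDistF ℓ c F d =
      (∃[ j ] ∃[ k ] (¬ j ≡ k) × ∃[ t ] Dist (F j t) (F k t) d)
    × (∀ j k → ¬ j ≡ k → ∀ t → DistGe (F j t) (F k t) d)

  -- σ^×_V(G) = s (w = false), σ^⊠_V(G) = s (w = true)
  IsSigma : Bool → ℕ → Set
  IsSigma w s =
      (∃[ ℓ ] Σ (Fin (suc ℓ) → V) λ f → Σ (Fin (suc ℓ) → V) λ g →
         IsTrack w ℓ f × IsTrack w ℓ g × MinDist ℓ f g s)
    × (∀ ℓ f g d → IsTrack w ℓ f → IsTrack w ℓ g → MinDist ℓ f g d → d ≤ s)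

  -- cap^×_d(G) = c (w = false), cap^⊠_d(G) = c (w = true)
  IsCap : Bool → ℕ → ℕ → Set
  IsCap w d c =
      (∃[ ℓ ] Σ (Fin c → Fin (suc ℓ) → V) λ F → IsTour w ℓ c F × MinDistF ℓ c F d)
    × (∀ ℓ c' (F : Fin c' → Fin (suc ℓ) → V) → IsTour w ℓ c' F → MinDistF ℓ c' F d → c' ≤ c)

-- At two consecutive times every track of a tour stands on the two ends of an
-- edge, one of which lies in X; tracks that stay at distance ≥ 2 cannot share
-- that vertex, so a tour with m_G = 2 has at most |X| tracks. In K_{X,Y} the
-- diameter is 2, and |X| tracks attain the bound: the j-th is at the X-vertex
-- numbered (j + s) mod |X| at time 2s and at the Y-vertex numbered
-- (j + s) mod |Y| at time 2s + 1, which keeps distinct tracks on distinct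
-- vertices of the same side and covers X ∪ Y by time 2|Y| since |X| ≤ |Y|.
-- Weak tours obey the same bound in K_{X,Y}: when one track is at some x ∈ X,
-- every other track is at a non-neighbour of x, i.e. in X.
module Submission where

open import Defs
open import Data.Nat using (ℕ; zero; suc; _+_; _*_; _≤_; _<_; z≤n; s≤s; NonZero; >-nonZero)
open import Data.Nat.Properties using (≤-trans; <⇒≤; +-mono-≤; +-assoc; +-comm; +-suc; *-comm)
open import Data.Nat.DivMod using (_%_; _mod_; %-distribˡ-+; m%n%n≡m%n; [m+kn]%n≡m%n; m<n⇒m%n≡m; m%n<n)
open import Data.Fin using (Fin; toℕ; fromℕ<; inject₁; _≟_) renaming (zero to fzero; suc to fsuc)
open import Data.Fin.Properties using (toℕ-injective; toℕ-fromℕ<; toℕ-inject₁; toℕ<n; injective⇒≤; suc-injective)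
open import Data.Fin.Subset using (Subset; _∈_; _∉_; ∣_∣; ∁)
open import Data.Fin.Subset.Properties using (_∈?_; x∈∁p⇒x∉p; x∉p⇒x∈∁p)
open import Data.Vec.Base using (_∷_; here; there)
open import Data.Bool using (true; false)
open import Data.Product using (_×_; _,_; proj₁; proj₂; ∃-syntax)
open import Data.Sum using (_⊎_; inj₁; inj₂)
open import Function using (_∘_)
open import Level using (Level)
open import Relation.Nullary using (¬_; yes; no; contradiction)
open import Relation.Binary.PropositionalEquality
  using (_≡_; _≢_; refl; sym; trans; cong; subst; module ≡-Reasoning)

private
  variable
    a r : Level
    A : Set a
    m : ℕ

enum : (p : Subset m) → Fin ∣ p ∣ → Fin m
enum (true  ∷ p) fzero    = fzero
enum (true  ∷ p) (fsuc i) = fsuc (enum p i)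
enum (false ∷ p) i        = fsuc (enum p i)

enum-∈ : (p : Subset m) (i : Fin ∣ p ∣) → enum p i ∈ p
enum-∈ (true  ∷ p) fzero    = here
enum-∈ (true  ∷ p) (fsuc i) = there (enum-∈ p i)
enum-∈ (false ∷ p) i        = there (enum-∈ p i)

enum-surjective : (p : Subset m) {x : Fin m} → x ∈ p → ∃[ i ] enum p i ≡ x
enum-surjective (true  ∷ p) here      = fzero , refl
enum-surjective (true  ∷ p) (there x∈p) with enum-surjective p x∈p
... | i , eq = fsuc i , cong fsuc eq
enum-surjective (false ∷ p) (there x∈p) with enum-surjective p x∈p
... | i , eq = i , cong fsuc eq

enum-injective : (p : Subset m) {i j : Fin ∣ p ∣} → enum p i ≡ enum p j → i ≡ j
enum-injective (true  ∷ p) {fzero}  {fzero}  _  = refl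
enum-injective (true  ∷ p) {fsuc i} {fsuc j} eq = cong fsuc (enum-injective p (suc-injective eq))
enum-injective (false ∷ p)                   eq = enum-injective p (suc-injective eq)

∈-injection⇒≤∣p∣ : ∀ {c} (p : Subset m) (φ : Fin c → Fin m) →
  (∀ j → φ j ∈ p) → (∀ j k → j ≢ k → φ j ≢ φ k) → c ≤ ∣ p ∣
∈-injection⇒≤∣p∣ p φ φ∈p φ-inj = injective⇒≤ {f = index} index-injective
  where
  index : _ → Fin ∣ p ∣
  index j = proj₁ (enum-surjective p (φ∈p j))

  index-injective : ∀ {j k} → index j ≡ index k → j ≡ k
  index-injective {j} {k} eq with j ≟ k
  ... | yes j≡k = j≡k
  ... | no  j≢k = contradiction
    (trans (sym (proj₂ (enum-surjective p (φ∈p j))))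
           (trans (cong (enum p) eq) (proj₂ (enum-surjective p (φ∈p k)))))
    (φ-inj j k j≢k)

[m%d+n]%d≡[m+n]%d : ∀ m n d .{{_ : NonZero d}} → (m % d + n) % d ≡ (m + n) % d
[m%d+n]%d≡[m+n]%d m n d = begin
  (m % d + n) % d           ≡⟨ %-distribˡ-+ (m % d) n d ⟩
  (m % d % d + n % d) % d   ≡⟨ cong (λ z → (z + n % d) % d) (m%n%n≡m%n m d) ⟩
  (m % d + n % d) % d       ≡⟨ %-distribˡ-+ m n d ⟨
  (m + n) % d               ∎
  where open ≡-Reasoning

[[m+n]%d+o]%d≡m%d : ∀ m n o q d .{{_ : NonZero d}} → n + o ≡ q * d →
  ((m + n) % d + o) % d ≡ m % d
[[m+n]%d+o]%d≡m%d m n o q d n+o≡qd = begin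
  ((m + n) % d + o) % d   ≡⟨ [m%d+n]%d≡[m+n]%d (m + n) o d ⟩
  (m + n + o) % d         ≡⟨ cong (_% d) (+-assoc m n o) ⟩
  (m + (n + o)) % d       ≡⟨ cong (λ z → (m + z) % d) n+o≡qd ⟩
  (m + q * d) % d         ≡⟨ [m+kn]%n≡m%n m q d ⟩
  m % d                   ∎
  where open ≡-Reasoning

-- Adding s is undone modulo 1 + d by adding d * s.
[m+s]%d-injective : ∀ {d} .{{_ : NonZero d}} {j k} s → j < d → k < d →
  (j + s) % d ≡ (k + s) % d → j ≡ k
[m+s]%d-injective {zero}  s () _
[m+s]%d-injective {suc d} {j = j} {k} s j<d k<d eq = begin
  j                                 ≡⟨ m<n⇒m%n≡m j<d ⟨
  j % suc d                         ≡⟨ [[m+n]%d+o]%d≡m%d j s (d * s) s (suc d) (*-comm (suc d) s) ⟨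
  ((j + s) % suc d + d * s) % suc d ≡⟨ cong (λ z → (z + d * s) % suc d) eq ⟩
  ((k + s) % suc d + d * s) % suc d ≡⟨ [[m+n]%d+o]%d≡m%d k s (d * s) s (suc d) (*-comm (suc d) s) ⟩
  k % suc d                         ≡⟨ m<n⇒m%n≡m k<d ⟩
  k                                 ∎
  where open ≡-Reasoning

[m+s]%d-surjective : ∀ {d} .{{_ : NonZero d}} j {w} → w < d → ∃[ s ] s < d × (j + s) % d ≡ w
[m+s]%d-surjective {zero}  j ()
[m+s]%d-surjective {suc d} j {w} w<d = s , m%n<n (w + d * j) (suc d) , (begin
  (j + s) % suc d   ≡⟨ cong (_% suc d) (+-comm j s) ⟩
  (s + j) % suc d   ≡⟨ [[m+n]%d+o]%d≡m%d w (d * j) j j (suc d) d*j+j≡j*[1+d] ⟩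
  w % suc d         ≡⟨ m<n⇒m%n≡m w<d ⟩
  w                 ∎)
  where
  open ≡-Reasoning
  s = (w + d * j) % suc d
  d*j+j≡j*[1+d] : d * j + j ≡ j * suc d
  d*j+j≡j*[1+d] = trans (+-comm (d * j) j) (*-comm (suc d) j)

rotate : (p : Subset m) .{{_ : NonZero ∣ p ∣}} → ℕ → Fin m
rotate p k = enum p (k mod ∣ p ∣)

rotate-∈ : (p : Subset m) .{{_ : NonZero ∣ p ∣}} (k : ℕ) → rotate p k ∈ p
rotate-∈ p k = enum-∈ p (k mod ∣ p ∣)

rotate-injective : (p : Subset m) .{{_ : NonZero ∣ p ∣}} {j k : ℕ} (s : ℕ) →
  j < ∣ p ∣ → k < ∣ p ∣ →
  rotate p (j + s) ≡ rotate p (k + s) → j ≡ k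
rotate-injective p {j} {k} s j<∣p∣ k<∣p∣ eq = [m+s]%d-injective s j<∣p∣ k<∣p∣ (begin
  (j + s) % ∣ p ∣             ≡⟨ toℕ-fromℕ< (m%n<n (j + s) ∣ p ∣) ⟨
  toℕ ((j + s) mod ∣ p ∣)     ≡⟨ cong toℕ (enum-injective p eq) ⟩
  toℕ ((k + s) mod ∣ p ∣)     ≡⟨ toℕ-fromℕ< (m%n<n (k + s) ∣ p ∣) ⟩
  (k + s) % ∣ p ∣             ∎)
  where open ≡-Reasoning

rotate-surjective : (p : Subset m) .{{_ : NonZero ∣ p ∣}} (j : ℕ) {x : Fin m} → x ∈ p →
  ∃[ s ] s < ∣ p ∣ × rotate p (j + s) ≡ x
rotate-surjective p j x∈p with enum-surjective p x∈p
... | i , enum-i≡x with [m+s]%d-surjective j (toℕ<n i)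
...   | s , s<∣p∣ , eq =
  s , s<∣p∣ , trans (cong (enum p) (toℕ-injective (trans (toℕ-fromℕ< _) eq))) enum-i≡x

interleave : (ℕ → A) → (ℕ → A) → ℕ → A
interleave f g zero    = f 0
interleave f g (suc t) = interleave g (f ∘ suc) t

interleave-even : (f g : ℕ → A) (s : ℕ) → interleave f g (s + s) ≡ f s
interleave-even f g zero    = refl
interleave-even f g (suc s) =
  trans (cong (interleave g (f ∘ suc)) (+-suc s s)) (interleave-even (f ∘ suc) (g ∘ suc) s)

interleave-odd : (f g : ℕ → A) (s : ℕ) → interleave f g (suc (s + s)) ≡ g s
interleave-odd f g = interleave-even g (f ∘ suc)

interleave-step : {R : A → A → Set r} {f g : ℕ → A} →
  (∀ s → R (f s) (g s)) → (∀ s → R (g s) (f (suc s))) →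
  ∀ t → R (interleave f g t) (interleave f g (suc t))
interleave-step fg gf zero    = fg 0
interleave-step {R = R} fg gf (suc t) = interleave-step {R = R} gf (fg ∘ suc) t

interleave-pointwise : {R : A → A → Set r} {f g f′ g′ : ℕ → A} →
  (∀ s → R (f s) (f′ s)) → (∀ s → R (g s) (g′ s)) →
  ∀ t → R (interleave f g t) (interleave f′ g′ t)
interleave-pointwise ff gg zero    = ff 0
interleave-pointwise {R = R} ff gg (suc t) = interleave-pointwise {R = R} gg (ff ∘ suc) t

module _ {G : Graph} where
  open Graph G renaming (sym to Adj-sym)

  DistGe-2⇒≢ : ∀ {u v} → DistGe G u v 2 → u ≢ v
  DistGe-2⇒≢ u≥2 refl with u≥2 0 here
  ... | ()

  DistGe-2⇒¬Adj : ∀ {u v} → DistGe G u v 2 → ¬ Adj u v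
  DistGe-2⇒¬Adj u≥2 uv with u≥2 1 (step uv here)
  ... | s≤s ()

  Dist⇒≤ : ∀ {u v d k} → Dist G u v d → Walk G u v k → d ≤ k
  Dist⇒≤ (_ , d≤) = d≤ _

  walk₂ : ∀ {u w v} → Adj u w → Adj w v → Walk G u v 2
  walk₂ uw wv = step uw (step wv here)

  sequence⇒track : ∀ {w} ℓ (p : ℕ → V G) →
    (∀ t → Step G w (p t) (p (suc t))) → (∀ v → ∃[ t ] t ≤ ℓ × p t ≡ v) →
    IsTrack G w ℓ (p ∘ toℕ)
  sequence⇒track {w} ℓ p steps covers = steps′ , covers′
    where
    steps′ : ∀ (i : Fin ℓ) → Step G w (p (toℕ (inject₁ i))) (p (suc (toℕ i)))
    steps′ i = subst (λ t → Step G w (p t) (p (suc (toℕ i)))) (sym (toℕ-inject₁ i)) (steps (toℕ i))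
    covers′ : ∀ v → ∃[ i ] p (toℕ i) ≡ v
    covers′ v with covers v
    ... | t , t≤ℓ , pt≡v = fromℕ< (s≤s t≤ℓ) , trans (cong p (toℕ-fromℕ< (s≤s t≤ℓ))) pt≡v

  track⇒weakTrack : ∀ {ℓ f} → IsTrack G false ℓ f → IsTrack G true ℓ f
  track⇒weakTrack (steps , covers) = inj₂ ∘ steps , covers

  tour⇒weakTour : ∀ {ℓ c F} → IsTour G false ℓ c F → IsTour G true ℓ c F
  tour⇒weakTour (tracks , distinct) = track⇒weakTrack ∘ tracks , distinct

  σ-and-cap-attained : ∀ {w ℓ c d} {F : Fin c → Fin (suc ℓ) → V G} →
    IsTour G w ℓ c F → MinDistF G ℓ c F d →
    (∀ ℓ′ f g d′ → MinDist G ℓ′ f g d′ → d′ ≤ d) →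
    (∀ ℓ′ c′ (F′ : Fin c′ → Fin (suc ℓ′) → V G) →
       IsTour G w ℓ′ c′ F′ → MinDistF G ℓ′ c′ F′ d → c′ ≤ c) →
    IsSigma G w d × IsCap G w d c
  σ-and-cap-attained {ℓ = ℓ} {F = F} tour@(tracks , _) minF@((j , k , j≢k , attained) , separated) σ≤ cap≤ =
    ((ℓ , F j , F k , tracks j , tracks k , attained , separated j k j≢k) ,
      λ ℓ′ f g d′ _ _ → σ≤ ℓ′ f g d′) ,
    ((ℓ , F , tour , minF) , cap≤)

  module Bipartite (X : Subset n) (bip : IsBipartition G X) where

    sameSide⇒DistGe-2 : ∀ {u v} → u ≢ v → (u ∈ X × v ∈ X) ⊎ (u ∉ X × v ∉ X) → DistGe G u v 2
    sameSide⇒DistGe-2 u≢v _                  zero          here           =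
      contradiction refl u≢v
    sameSide⇒DistGe-2 _   (inj₁ (u∈X , v∈X)) (suc zero)    (step uv here) =
      contradiction v∈X (proj₁ (bip _ _ uv) u∈X)
    sameSide⇒DistGe-2 _   (inj₂ (u∉X , v∉X)) (suc zero)    (step uv here) =
      contradiction (proj₂ (bip _ _ uv) u∉X) v∉X
    sameSide⇒DistGe-2 _   _                  (suc (suc k)) _              =
      s≤s (s≤s z≤n)

    edge-meets-X : ∀ {u v} → Adj u v → ∃[ x ] x ∈ X × (x ≡ u ⊎ x ≡ v)
    edge-meets-X {u} {v} uv with u ∈? X
    ... | yes u∈X = u , u∈X , inj₁ refl
    ... | no  u∉X = v , proj₂ (bip _ _ uv) u∉X , inj₂ refl

    -- A 0-track visits every vertex at time 0, so G has only one vertex.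
    cap₂-bound : ∀ ℓ c (F : Fin c → Fin (suc ℓ) → V G) →
      IsTour G false ℓ c F → MinDistF G ℓ c F 2 → c ≤ ∣ X ∣
    cap₂-bound zero c F (tracks , _) ((j , k , _ , fzero , _ , Fj≥2) , _)
      with proj₂ (tracks j) (F k fzero)
    ... | fzero , Fj≡Fk = contradiction Fj≡Fk (DistGe-2⇒≢ Fj≥2)
    cap₂-bound (suc ℓ) c F (tracks , _) (_ , separated) = ∈-injection⇒≤∣p∣ X φ φ∈X φ-injective
      where
      first-edge : ∀ j → Adj (F j fzero) (F j (fsuc fzero))
      first-edge j = proj₁ (tracks j) fzero

      φ : Fin c → V G
      φ j = proj₁ (edge-meets-X (first-edge j))

      φ∈X : ∀ j → φ j ∈ X
      φ∈X j = proj₁ (proj₂ (edge-meets-X (first-edge j)))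

      φ-injective : ∀ j k → j ≢ k → φ j ≢ φ k
      φ-injective j k j≢k with edge-meets-X (first-edge j) | edge-meets-X (first-edge k)
      ... | _ , _ , inj₁ refl | _ , _ , inj₁ refl = DistGe-2⇒≢ (separated j k j≢k fzero)
      ... | _ , _ , inj₂ refl | _ , _ , inj₂ refl = DistGe-2⇒≢ (separated j k j≢k (fsuc fzero))
      ... | _ , _ , inj₁ refl | _ , _ , inj₂ refl = λ eq →
        DistGe-2⇒¬Adj (separated j k j≢k fzero)
          (subst (λ x → Adj x (F k fzero)) (sym eq) (Adj-sym (first-edge k)))
      ... | _ , _ , inj₂ refl | _ , _ , inj₁ refl = λ eq →
        DistGe-2⇒¬Adj (separated j k j≢k fzero) (subst (Adj (F j fzero)) eq (first-edge j))

  module CompleteBipartite (X : Subset n) (bip : IsBipartition G X)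
                           (complete : ∀ u v → u ∈ X → v ∉ X → Adj u v) where

    ¬Adj⇒∈ : ∀ {x v} → x ∈ X → ¬ Adj x v → v ∈ X
    ¬Adj⇒∈ {x} {v} x∈X ¬xv with v ∈? X
    ... | yes v∈X = v∈X
    ... | no  v∉X = contradiction (complete x v x∈X v∉X) ¬xv

    diameter≤2 : ∀ {x₀ y₀} → x₀ ∈ X → y₀ ∉ X → ∀ u v → ∃[ k ] k ≤ 2 × Walk G u v k
    diameter≤2 {x₀} {y₀} x₀∈X y₀∉X u v with u ∈? X | v ∈? X
    ... | yes u∈X | yes v∈X =
      2 , s≤s (s≤s z≤n) , walk₂ (complete u y₀ u∈X y₀∉X) (Adj-sym (complete v y₀ v∈X y₀∉X))
    ... | yes u∈X | no  v∉X = 1 , s≤s z≤n , step (complete u v u∈X v∉X) here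
    ... | no  u∉X | yes v∈X = 1 , s≤s z≤n , step (Adj-sym (complete v u v∈X u∉X)) here
    ... | no  u∉X | no  v∉X =
      2 , s≤s (s≤s z≤n) , walk₂ (Adj-sym (complete x₀ u x₀∈X u∉X)) (complete x₀ v x₀∈X v∉X)

    minDist≤2 : ∀ {x₀ y₀} → x₀ ∈ X → y₀ ∉ X → ∀ ℓ f g d → MinDist G ℓ f g d → d ≤ 2
    minDist≤2 x₀∈X y₀∉X ℓ f g d ((i , dist) , _) with diameter≤2 x₀∈X y₀∉X (f i) (g i)
    ... | k , k≤2 , walk = ≤-trans (Dist⇒≤ dist walk) k≤2

    weak-cap₂-bound : ∀ {x₀ w} → x₀ ∈ X → ∀ ℓ c (F : Fin c → Fin (suc ℓ) → V G) →
      IsTour G w ℓ c F → MinDistF G ℓ c F 2 → c ≤ ∣ X ∣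
    weak-cap₂-bound {x₀} x₀∈X ℓ c F (tracks , _) ((j , _) , separated) =
      ∈-injection⇒≤∣p∣ X φ φ∈X λ k k′ k≢k′ → DistGe-2⇒≢ (separated k k′ k≢k′ t)
      where
      t : Fin (suc ℓ)
      t = proj₁ (proj₂ (tracks j) x₀)

      φ : Fin c → V G
      φ k = F k t

      φ∈X : ∀ k → φ k ∈ X
      φ∈X k with k ≟ j
      ... | yes refl = subst (_∈ X) (sym (proj₂ (proj₂ (tracks j) x₀))) x₀∈X
      ... | no  k≢j  = ¬Adj⇒∈ x₀∈X (subst (λ x → ¬ Adj x (F k t)) (proj₂ (proj₂ (tracks j) x₀))
                         (DistGe-2⇒¬Adj (separated j k (k≢j ∘ sym) t)))

    module RotationTour (2≤∣X∣ : 2 ≤ ∣ X ∣) (∣X∣≤∣Y∣ : ∣ X ∣ ≤ ∣ ∁ X ∣) where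
      open Bipartite X bip

      instance
        ∣X∣-nonZero : NonZero ∣ X ∣
        ∣X∣-nonZero = >-nonZero (≤-trans (s≤s z≤n) 2≤∣X∣)
        ∣Y∣-nonZero : NonZero ∣ ∁ X ∣
        ∣Y∣-nonZero = >-nonZero (≤-trans (s≤s z≤n) (≤-trans 2≤∣X∣ ∣X∣≤∣Y∣))

      x₀ y₀ : V G
      x₀ = rotate X 0
      y₀ = rotate (∁ X) 0

      x₀∈X : x₀ ∈ X
      x₀∈X = rotate-∈ X 0

      y₀∉X : y₀ ∉ X
      y₀∉X = x∈∁p⇒x∉p (rotate-∈ (∁ X) 0)

      route : ℕ → ℕ → V G
      route j = interleave (λ s → rotate X (j + s)) (λ s → rotate (∁ X) (j + s))

      ℓ₀ : ℕ
      ℓ₀ = ∣ ∁ X ∣ + ∣ ∁ X ∣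

      route-steps : ∀ j t → Adj (route j t) (route j (suc t))
      route-steps j = interleave-step {R = Adj}
        (λ s → complete _ _ (rotate-∈ X (j + s)) (x∈∁p⇒x∉p (rotate-∈ (∁ X) (j + s))))
        (λ s → Adj-sym (complete _ _ (rotate-∈ X (j + suc s)) (x∈∁p⇒x∉p (rotate-∈ (∁ X) (j + s)))))

      route-covers : ∀ j v → ∃[ t ] t ≤ ℓ₀ × route j t ≡ v
      route-covers j v with v ∈? X
      ... | yes v∈X with rotate-surjective X j v∈X
      ...   | s , s<∣X∣ , eq = s + s , +-mono-≤ s≤∣Y∣ s≤∣Y∣ , trans (interleave-even _ _ s) eq
        where s≤∣Y∣ = ≤-trans (<⇒≤ s<∣X∣) ∣X∣≤∣Y∣
      route-covers j v | no v∉X with rotate-surjective (∁ X) j (x∉p⇒x∈∁p v∉X)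
      ...   | s , s<∣Y∣ , eq =
        suc (s + s) , +-mono-≤ s<∣Y∣ (<⇒≤ s<∣Y∣) , trans (interleave-odd (λ s → rotate X (j + s)) _ s) eq

      route-separated : ∀ {j k} → j < ∣ X ∣ → k < ∣ X ∣ → j ≢ k →
        ∀ t → DistGe G (route j t) (route k t) 2
      route-separated j<∣X∣ k<∣X∣ j≢k = interleave-pointwise {R = λ u v → DistGe G u v 2}
        (λ s → sameSide⇒DistGe-2 (j≢k ∘ rotate-injective X s j<∣X∣ k<∣X∣)
                 (inj₁ (rotate-∈ X _ , rotate-∈ X _)))
        (λ s → sameSide⇒DistGe-2
                 (j≢k ∘ rotate-injective (∁ X) s (≤-trans j<∣X∣ ∣X∣≤∣Y∣) (≤-trans k<∣X∣ ∣X∣≤∣Y∣))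
                 (inj₂ (x∈∁p⇒x∉p (rotate-∈ (∁ X) _) , x∈∁p⇒x∉p (rotate-∈ (∁ X) _))))

      F : Fin ∣ X ∣ → Fin (suc ℓ₀) → V G
      F j = route (toℕ j) ∘ toℕ

      F-separated : ∀ j k → j ≢ k → ∀ t → DistGe G (F j t) (F k t) 2
      F-separated j k j≢k t = route-separated (toℕ<n j) (toℕ<n k) (j≢k ∘ toℕ-injective) (toℕ t)

      tour : IsTour G false ℓ₀ ∣ X ∣ F
      tour = (λ j → sequence⇒track {w = false} ℓ₀ (route (toℕ j))
                      (route-steps (toℕ j)) (route-covers (toℕ j))) ,
             λ j k j≢k → fzero , DistGe-2⇒≢ (F-separated j k j≢k fzero)

      j₀ k₀ : Fin ∣ X ∣
      j₀ = fromℕ< (≤-trans (s≤s z≤n) 2≤∣X∣)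
      k₀ = fromℕ< 2≤∣X∣

      j₀≢k₀ : j₀ ≢ k₀
      j₀≢k₀ eq with trans (sym (toℕ-fromℕ< _)) (trans (cong toℕ eq) (toℕ-fromℕ< 2≤∣X∣))
      ... | ()

      minDistF : MinDistF G ℓ₀ ∣ X ∣ F 2
      minDistF = (j₀ , k₀ , j₀≢k₀ , fzero , walk , F-separated j₀ k₀ j₀≢k₀ fzero) , F-separated
        where
        walk : Walk G (F j₀ fzero) (F k₀ fzero) 2
        walk = walk₂ (complete _ y₀ (rotate-∈ X _) y₀∉X) (Adj-sym (complete _ y₀ (rotate-∈ X _) y₀∉X))

proposition3p13 : (G : Graph) (X : Subset (Graph.n G)) →
    Connected G → IsBipartition G X → 2 ≤ ∣ X ∣ → ∣ X ∣ ≤ ∣ ∁ X ∣ →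
      ((ℓ c : ℕ) (F : Fin c → Fin (suc ℓ) → V G) →
          IsTour G false ℓ c F → MinDistF G ℓ c F 2 → c ≤ ∣ X ∣)
      × (IsCompleteBipartite G X →
          (∃[ s ] IsSigma G false s × IsCap G false s ∣ X ∣)
          × (∃[ s ] IsSigma G true s × IsCap G true s ∣ X ∣))
proposition3p13 G X _ bip 2≤∣X∣ ∣X∣≤∣Y∣ = cap₂-bound , λ (_ , complete) →
  let open CompleteBipartite X bip complete
      open RotationTour 2≤∣X∣ ∣X∣≤∣Y∣
      σ≤2 = minDist≤2 x₀∈X y₀∉X
  in  (2 , σ-and-cap-attained tour minDistF σ≤2 cap₂-bound) ,
      (2 , σ-and-cap-attained {w = true} (tour⇒weakTour {G = G} tour) minDistF σ≤2
                              (weak-cap₂-bound {w = true} x₀∈X))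
  where open Bipartite {G} X bip
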